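{- Let $p$ be a prime and let $U\subseteq\mathbb F_p^2$ with $\#U=np-r$, where $n,r$ are integers with $1\leq n<p$, $0\leq r<p$ and $p-r\leq n$. Let $m_0\in\mathbb F_p\cup\{\infty\}$ be a direction such that no direction other than $m_0$ is $U$-special. Then every line with slope $m_0$ is either contained in $U$ or meets $U$ in at most $p-r$ points.
   Context: A line of $\mathbb F_p^2$ is either $\{(u,v): v=mu-k\}$ with $m,k\in\mathbb F_p$ (slope $m$) or a vertical set $\{(u,v):u=c\}$ (slope $\infty$); directions are elements of $\mathbb F_p\cup\{\infty\}$. For $U\subseteq\mathbb F_p^2$ put $\theta=\#U/p$; a line $\ell$ is $U$-rich if $\#(\ell\cap U)\geq\theta+1$ and $U$-poor if $\#(\ell\cap U)\leq\theta-1$; a direction is $U$-special if some line with that slope is $U$-rich or $U$-poor. -}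

module Defs where

open import Data.Nat using (ℕ; zero; suc; _+_; _*_; _∸_; _≤_; NonZero; _≡ᵇ_)
open import Data.Nat.DivMod using (_%_)
open import Data.Fin using (Fin; toℕ)
open import Data.Bool using (Bool; true; false; _∧_; if_then_else_)
open import Data.Maybe using (Maybe; just; nothing)
open import Data.List using (List; map; allFin)
open import Data.Nat.ListAction using (sum)
open import Relation.Binary.PropositionalEquality using (_≡_)
open import Data.Product using (Σ; _×_; _,_)
open import Data.Sum using (_⊎_)

-- F_p is modelled by Fin p (residues 0..p-1); arithmetic is done mod p.
-- A point of F_p^2 is a pair (u , v).
Point : ℕ → Set
Point p = Fin p × Fin p

SubsetP : ℕ → Set
SubsetP p = Point p → Bool

-- Directions: elements of F_p ∪ {∞}; `just m` is slope m, `nothing` is ∞.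
Direction : ℕ → Set
Direction p = Maybe (Fin p)

_≡ₚ_[_] : ℕ → ℕ → (p : ℕ) → .{{NonZero p}} → Bool
a ≡ₚ b [ p ] = (a % p) ≡ᵇ (b % p)

-- The line with direction d and parameter k:
--   d = just m : { (u,v) : v = m u - k }   (checked as  v + k = m u  in F_p)
--   d = nothing : { (u,v) : u = k }        (vertical line)
-- Every line of F_p^2 is of this form for a unique (d , k).
onLine : (p : ℕ) → .{{NonZero p}} → Direction p → Fin p → Point p → Bool
onLine p (just m) k (u , v) = (toℕ v + toℕ k) ≡ₚ (toℕ m * toℕ u) [ p ]
onLine p nothing  c (u , v) = toℕ u ≡ᵇ toℕ c

countP : (p : ℕ) → (Point p → Bool) → ℕ
countP p P = sum (map (λ u → sum (map (λ v → if P (u , v) then 1 else 0) (allFin p))) (allFin p))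

card : (p : ℕ) → SubsetP p → ℕ
card p U = countP p U

lineCount : (p : ℕ) → .{{NonZero p}} → SubsetP p → Direction p → Fin p → ℕ
lineCount p U d k = countP p (λ x → onLine p d k x ∧ U x)

-- θ = #U / p.  Rich: #(ℓ∩U) ≥ θ + 1, i.e. (multiplying by p > 0)  #U + p ≤ p·#(ℓ∩U).
Rich : (p : ℕ) → .{{NonZero p}} → SubsetP p → Direction p → Fin p → Set
Rich p U d k = card p U + p ≤ p * lineCount p U d k

-- Poor: #(ℓ∩U) ≤ θ − 1, i.e.  p·#(ℓ∩U) + p ≤ #U.
Poor : (p : ℕ) → .{{NonZero p}} → SubsetP p → Direction p → Fin p → Set
Poor p U d k = p * lineCount p U d k + p ≤ card p U

Special : (p : ℕ) → .{{NonZero p}} → SubsetP p → Direction p → Set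
Special p U d = Σ (Fin p) (λ k → Rich p U d k ⊎ Poor p U d k)

LineInU : (p : ℕ) → .{{NonZero p}} → SubsetP p → Direction p → Fin p → Set
LineInU p U d k = (x : Point p) → onLine p d k x ≡ true → U x ≡ true

module Submission where

-- Suppose the line ℓ of slope m₀ is not contained in U, and pick P ∈ ℓ ∖ U.  The p + 1
-- lines through P (one for each direction) pairwise meet only in P, which is not in U,
-- so their intersections with U are disjoint and
--   #(ℓ ∩ U) + Σ_{d ≠ m₀} #(ℓ_d ∩ U) ≤ #U = np − r.
-- None of the p lines ℓ_d with d ≠ m₀ is U-poor, so each meets U in at least n − 1
-- points; hence #(ℓ ∩ U) ≤ np − r − p(n − 1) = p − r.

open import Defs
open import Data.Nat.Base using (ℕ; zero; suc; NonZero)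
open import Data.Nat.DivMod using (_%_; _/_; _mod_; m≡m%n+[m/n]*n; %-distribˡ-+; m%n%n≡m%n; [m+n]%n≡m%n; m%n<n)
open import Data.Nat.Primality using (Prime; euclidsLemma)
open import Data.Nat.ListAction using (sum)
open import Data.Bool.Base using (Bool; true; false; _∧_; if_then_else_)
open import Data.Bool.Properties using (T-≡; ¬-not; not-¬)
import Data.Bool.Properties as Bool
open import Data.Fin.Base using (Fin; toℕ)
open import Data.Fin.Properties using (toℕ-injective; toℕ<n; toℕ-fromℕ<; any?)
import Data.Fin.Properties as Fin
open import Data.Maybe.Base using (just; nothing)
open import Data.Maybe.Properties using (just-injective)
open import Data.List.Base using (List; []; _∷_; map; allFin; length)
open import Data.List.Properties using (map-cong; length-map; length-tabulate)
open import Data.List.Relation.Unary.All using (All; []; _∷_; universal; zipWith)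
import Data.List.Relation.Unary.All as All
import Data.List.Relation.Unary.All.Properties as All
open import Data.List.Relation.Unary.AllPairs using (AllPairs; []; _∷_)
import Data.List.Relation.Unary.AllPairs as AllPairs
import Data.List.Relation.Unary.AllPairs.Properties as AllPairs
open import Data.List.Relation.Unary.Unique.Propositional.Properties using (allFin⁺)
open import Data.Product.Base using (∃-syntax; _×_; _,_; proj₁; proj₂)
open import Data.Sum.Base using (_⊎_; inj₁; inj₂; [_,_]′)
import Data.Sum.Base as Sum
open import Data.Empty using (⊥-elim)
open import Function.Base using (id; _∘_; _on_)
open import Function.Bundles using (Equivalence)
open import Relation.Binary.PropositionalEquality
open import Relation.Nullary using (¬_; yes; no; contradiction)
open import Relation.Nullary.Decidable using (_×-dec_)

-- Two lines of F_p² with different directions meet in at most one point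

module _ (p : ℕ) .{{_ : NonZero p}} where
  open import Data.Nat.Base using (_<_; _⊔_)
  import Data.Nat.Base as ℕ
  open import Data.Nat.Properties using (≡ᵇ⇒≡; ⊔-lub; ≤-<-trans)
  open import Data.Nat.Divisibility using (>⇒∤) renaming (_∣_ to _∣ℕ_)
  open import Data.Integer.Base using (ℤ; +_; _+_; _-_; _*_)
  import Data.Integer.Base as ℤ
  open import Data.Integer.Properties using (+-injective; ∣i∣≡0⇒i≡0; i-j≡0⇒i≡j; [+m]-[+n]≡m⊖n; ∣m⊝n∣≤m⊔n; abs-*; pos-+; pos-*)
  open import Data.Integer.Divisibility.Signed using (_∣_; divides; ∣m∣n⇒∣m-n; ∣ᵤ⇒∣; ∣⇒∣ᵤ)
  open import Data.Integer.Tactic.RingSolver using (solve-∀)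

  ⟦_⟧ : Fin p → ℤ
  ⟦ i ⟧ = + toℕ i

  +a≡+[a%p]+[a/p]*p : ∀ a → + a ≡ + (a % p) + + (a / p) * + p
  +a≡+[a%p]+[a/p]*p a = begin
    + a                               ≡⟨ cong +_ (m≡m%n+[m/n]*n a p) ⟩
    + (a % p ℕ.+ a / p ℕ.* p)         ≡⟨ pos-+ (a % p) _ ⟩
    + (a % p) + + (a / p ℕ.* p)       ≡⟨ cong (_+_ (+ (a % p))) (pos-* (a / p) p) ⟩
    + (a % p) + + (a / p) * + p       ∎
    where open ≡-Reasoning

  %≡%⇒∣- : ∀ a b → a % p ≡ b % p → + p ∣ + a - + b
  %≡%⇒∣- a b a≡b = divides (+ (a / p) - + (b / p)) (begin
    + a - + b
      ≡⟨ cong₂ _-_ (+a≡+[a%p]+[a/p]*p a) (+a≡+[a%p]+[a/p]*p b) ⟩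
    (+ (a % p) + + (a / p) * + p) - (+ (b % p) + + (b / p) * + p)
      ≡⟨ cong (λ c → (+ c + + (a / p) * + p) - (+ (b % p) + + (b / p) * + p)) a≡b ⟩
    (+ (b % p) + + (a / p) * + p) - (+ (b % p) + + (b / p) * + p)
      ≡⟨ [c+xq]-[c+yq]≡[x-y]q (+ (b % p)) (+ (a / p)) (+ (b / p)) (+ p) ⟩
    (+ (a / p) - + (b / p)) * + p
      ∎)
    where
    open ≡-Reasoning
    [c+xq]-[c+yq]≡[x-y]q : ∀ c x y q → (c + x * q) - (c + y * q) ≡ (x - y) * q
    [c+xq]-[c+yq]≡[x-y]q = solve-∀

  ∣∧<⇒≡0 : ∀ {x} → p ∣ℕ x → x < p → x ≡ 0
  ∣∧<⇒≡0 {zero}  _   _   = refl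
  ∣∧<⇒≡0 {suc x} p∣x x<p = ⊥-elim (>⇒∤ x<p p∣x)

  ∣-⇒≡ : ∀ {a b} → a < p → b < p → + p ∣ + a - + b → a ≡ b
  ∣-⇒≡ {a} {b} a<p b<p p∣a-b = +-injective (i-j≡0⇒i≡j (+ a) (+ b) (∣i∣≡0⇒i≡0 ∣a-b∣≡0))
    where
    ∣a-b∣<p : ℤ.∣ + a - + b ∣ < p
    ∣a-b∣<p rewrite [+m]-[+n]≡m⊖n a b = ≤-<-trans (∣m⊝n∣≤m⊔n a b) (⊔-lub a<p b<p)
    ∣a-b∣≡0 : ℤ.∣ + a - + b ∣ ≡ 0
    ∣a-b∣≡0 = ∣∧<⇒≡0 (∣⇒∣ᵤ p∣a-b) ∣a-b∣<p

  ∣⟦-⟧⇒≡ : ∀ {i j} → + p ∣ ⟦ i ⟧ - ⟦ j ⟧ → i ≡ j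
  ∣⟦-⟧⇒≡ {i} {j} p∣i-j = toℕ-injective (∣-⇒≡ (toℕ<n i) (toℕ<n j) p∣i-j)

  prime-∣-* : Prime p → ∀ {x y} → + p ∣ x * y → + p ∣ x ⊎ + p ∣ y
  prime-∣-* p-prime {x} {y} p∣xy =
    Sum.map ∣ᵤ⇒∣ ∣ᵤ⇒∣ (euclidsLemma ℤ.∣ x ∣ ℤ.∣ y ∣ p-prime (subst (p ∣ℕ_) (abs-* x y) (∣⇒∣ᵤ p∣xy)))

  onSlope⇒∣ : ∀ {m k u v} → onLine p (just m) k (u , v) ≡ true →
              + p ∣ (⟦ v ⟧ + ⟦ k ⟧) - ⟦ m ⟧ * ⟦ u ⟧
  onSlope⇒∣ {m} {k} {u} {v} on =
    subst (+ p ∣_) (cong₂ _-_ (pos-+ (toℕ v) (toℕ k)) (pos-* (toℕ m) (toℕ u)))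
      (%≡%⇒∣- _ _ (≡ᵇ⇒≡ _ _ (Equivalence.from T-≡ on)))

  onVertical⇒≡ : ∀ {c u v} → onLine p nothing c (u , v) ≡ true → u ≡ c
  onVertical⇒≡ on = toℕ-injective (≡ᵇ⇒≡ _ _ (Equivalence.from T-≡ on))

  chord⇒∣ : ∀ {m k ux vx uy vy} →
            onLine p (just m) k (ux , vx) ≡ true → onLine p (just m) k (uy , vy) ≡ true →
            + p ∣ (⟦ vx ⟧ - ⟦ vy ⟧) - ⟦ m ⟧ * (⟦ ux ⟧ - ⟦ uy ⟧)
  chord⇒∣ {m} {k} {ux} {vx} {uy} {vy} onx ony =
    subst (+ p ∣_) (difference ⟦ vx ⟧ ⟦ vy ⟧ ⟦ k ⟧ ⟦ m ⟧ ⟦ ux ⟧ ⟦ uy ⟧) (∣m∣n⇒∣m-n (onSlope⇒∣ {m} {k} {ux} {vx} onx) (onSlope⇒∣ {m} {k} {uy} {vy} ony))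
    where
    difference : ∀ vx vy k m ux uy → ((vx + k) - m * ux) - ((vy + k) - m * uy) ≡ (vx - vy) - m * (ux - uy)
    difference = solve-∀

  onSlope-sameAbscissa⇒≡ : ∀ {m k ux vx uy vy} → ux ≡ uy →
    onLine p (just m) k (ux , vx) ≡ true → onLine p (just m) k (uy , vy) ≡ true → (ux , vx) ≡ (uy , vy)
  onSlope-sameAbscissa⇒≡ {m} {k} {u} {vx} {_} {vy} refl onx ony =
    cong (u ,_) (∣⟦-⟧⇒≡ {vx} {vy} (subst (+ p ∣_) (vertical-chord ⟦ vx ⟧ ⟦ vy ⟧ ⟦ m ⟧ ⟦ u ⟧)
                                     (chord⇒∣ {m} {k} {u} {vx} {u} {vy} onx ony)))
    where
    vertical-chord : ∀ vx vy m u → (vx - vy) - m * (u - u) ≡ vx - vy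
    vertical-chord = solve-∀

  chords⇒∣Δm*Δu : ∀ {m₁ m₂ k₁ k₂ ux vx uy vy} →
    onLine p (just m₁) k₁ (ux , vx) ≡ true → onLine p (just m₁) k₁ (uy , vy) ≡ true →
    onLine p (just m₂) k₂ (ux , vx) ≡ true → onLine p (just m₂) k₂ (uy , vy) ≡ true →
    + p ∣ (⟦ m₁ ⟧ - ⟦ m₂ ⟧) * (⟦ ux ⟧ - ⟦ uy ⟧)
  chords⇒∣Δm*Δu {m₁} {m₂} {k₁} {k₂} {ux} {vx} {uy} {vy} onx₁ ony₁ onx₂ ony₂ =
    subst (+ p ∣_) (chord-difference ⟦ vx ⟧ ⟦ vy ⟧ ⟦ m₁ ⟧ ⟦ m₂ ⟧ ⟦ ux ⟧ ⟦ uy ⟧)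
      (∣m∣n⇒∣m-n (chord⇒∣ {m₂} {k₂} {ux} {vx} {uy} {vy} onx₂ ony₂) (chord⇒∣ {m₁} {k₁} {ux} {vx} {uy} {vy} onx₁ ony₁))
    where
    chord-difference : ∀ vx vy m₁ m₂ ux uy →
      ((vx - vy) - m₂ * (ux - uy)) - ((vx - vy) - m₁ * (ux - uy)) ≡ (m₁ - m₂) * (ux - uy)
    chord-difference = solve-∀

  distinctSlopes-meetOnce : Prime p → ∀ {m₁ m₂ k₁ k₂ ux vx uy vy} → m₁ ≢ m₂ →
    onLine p (just m₁) k₁ (ux , vx) ≡ true → onLine p (just m₁) k₁ (uy , vy) ≡ true →
    onLine p (just m₂) k₂ (ux , vx) ≡ true → onLine p (just m₂) k₂ (uy , vy) ≡ true →
    (ux , vx) ≡ (uy , vy)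
  distinctSlopes-meetOnce p-prime {m₁} {m₂} {k₁} {k₂} {ux} {vx} {uy} {vy} m₁≢m₂ onx₁ ony₁ onx₂ ony₂ =
    [ (λ p∣Δm → ⊥-elim (m₁≢m₂ (∣⟦-⟧⇒≡ p∣Δm)))
    , (λ p∣Δu → onSlope-sameAbscissa⇒≡ {m₁} {k₁} {ux} {vx} {uy} {vy} (∣⟦-⟧⇒≡ p∣Δu) onx₁ ony₁)
    ]′ (prime-∣-* p-prime (chords⇒∣Δm*Δu {m₁} {m₂} {k₁} {k₂} {ux} {vx} {uy} {vy} onx₁ ony₁ onx₂ ony₂))

  verticalSlope-meetOnce : ∀ {c m k ux vx uy vy} →
    onLine p nothing c (ux , vx) ≡ true → onLine p nothing c (uy , vy) ≡ true →
    onLine p (just m) k (ux , vx) ≡ true → onLine p (just m) k (uy , vy) ≡ true →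
    (ux , vx) ≡ (uy , vy)
  verticalSlope-meetOnce {c} {m} {k} {ux} {vx} {uy} {vy} onx ony =
    onSlope-sameAbscissa⇒≡ {m} {k} {ux} {vx} {uy} {vy}
      (trans (onVertical⇒≡ {c} {ux} {vx} onx) (sym (onVertical⇒≡ {c} {uy} {vy} ony)))

  distinctDirections-meetOnce : Prime p → ∀ {d₁ d₂ k₁ k₂ x y} → d₁ ≢ d₂ →
    onLine p d₁ k₁ x ≡ true → onLine p d₁ k₁ y ≡ true →
    onLine p d₂ k₂ x ≡ true → onLine p d₂ k₂ y ≡ true → x ≡ y
  distinctDirections-meetOnce p-prime {nothing} {nothing} d₁≢d₂ = ⊥-elim (d₁≢d₂ refl)
  distinctDirections-meetOnce p-prime {nothing} {just m} {c} {k} {ux , vx} {uy , vy} _ onx₁ ony₁ onx₂ ony₂ =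
    verticalSlope-meetOnce {c} {m} {k} {ux} {vx} {uy} {vy} onx₁ ony₁ onx₂ ony₂
  distinctDirections-meetOnce p-prime {just m} {nothing} {k} {c} {ux , vx} {uy , vy} _ onx₁ ony₁ onx₂ ony₂ =
    verticalSlope-meetOnce {c} {m} {k} {ux} {vx} {uy} {vy} onx₂ ony₂ onx₁ ony₁
  distinctDirections-meetOnce p-prime {just m₁} {just m₂} {k₁} {k₂} {ux , vx} {uy , vy} d₁≢d₂ =
    distinctSlopes-meetOnce p-prime {m₁} {m₂} {k₁} {k₂} {ux} {vx} {uy} {vy} (d₁≢d₂ ∘ cong just)

open import Data.Nat.Base using (_+_; _*_; _∸_; _≤_; _<_; z≤n; s≤s)
open import Data.Nat.Properties
open import Algebra.Properties.CommutativeSemigroup +-commutativeSemigroup using (interchange; x∙yz≈y∙xz)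

indicator : Bool → ℕ
indicator b = if b then 1 else 0

module _ {a} {A : Set a} where

  sum-map-+ : ∀ (f g : A → ℕ) xs → sum (map f xs) + sum (map g xs) ≡ sum (map (λ x → f x + g x) xs)
  sum-map-+ f g []       = refl
  sum-map-+ f g (x ∷ xs) = trans (interchange (f x) _ (g x) _) (cong (f x + g x +_) (sum-map-+ f g xs))

  sum-map-0 : ∀ (xs : List A) → sum (map (λ _ → 0) xs) ≡ 0
  sum-map-0 []       = refl
  sum-map-0 (x ∷ xs) = sum-map-0 xs

  sum-map-mono-≤ : ∀ {f g : A → ℕ} → (∀ x → f x ≤ g x) → ∀ xs → sum (map f xs) ≤ sum (map g xs)
  sum-map-mono-≤ f≤g []       = z≤n
  sum-map-mono-≤ f≤g (x ∷ xs) = +-mono-≤ (f≤g x) (sum-map-mono-≤ f≤g xs)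

  length*c≤sum-map : ∀ {f : A → ℕ} {c xs} → All (λ x → c ≤ f x) xs → length xs * c ≤ sum (map f xs)
  length*c≤sum-map []           = z≤n
  length*c≤sum-map (c≤fx ∷ c≤f) = +-mono-≤ c≤fx (length*c≤sum-map c≤f)

  sum-map-indicator-∧ʳ : ∀ (g : A → Bool) c xs →
    sum (map (λ x → indicator (g x ∧ c)) xs) ≡ sum (map (indicator ∘ g) xs) * indicator c
  sum-map-indicator-∧ʳ g c [] = refl
  sum-map-indicator-∧ʳ g c (x ∷ xs) with g x
  ... | true  = cong (indicator c +_) (sum-map-indicator-∧ʳ g c xs)
  ... | false = sum-map-indicator-∧ʳ g c xs

  sum-map-indicator≡0 : ∀ {g : A → Bool} {xs} → All (λ x → g x ≢ true) xs → sum (map (indicator ∘ g) xs) ≡ 0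
  sum-map-indicator≡0 [] = refl
  sum-map-indicator≡0 {g} {x ∷ _} (gx≢true ∷ g≢true) with g x
  ... | true  = ⊥-elim (gx≢true refl)
  ... | false = sum-map-indicator≡0 g≢true

sum-map-comm : ∀ {a b} {A : Set a} {B : Set b} (F : A → B → ℕ) xs ys →
  sum (map (λ x → sum (map (F x) ys)) xs) ≡ sum (map (λ y → sum (map (λ x → F x y) xs)) ys)
sum-map-comm F []       ys = sym (sum-map-0 ys)
sum-map-comm F (x ∷ xs) ys = trans (cong (sum (map (F x) ys) +_) (sum-map-comm F xs ys)) (sum-map-+ (F x) _ ys)

module _ (p : ℕ) where

  ∑ᵖ : (Point p → ℕ) → ℕ
  ∑ᵖ f = sum (map (λ u → sum (map (λ v → f (u , v)) (allFin p))) (allFin p))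

  ∑ᵖ-mono-≤ : ∀ {f g} → (∀ x → f x ≤ g x) → ∑ᵖ f ≤ ∑ᵖ g
  ∑ᵖ-mono-≤ f≤g = sum-map-mono-≤ (λ u → sum-map-mono-≤ (λ v → f≤g (u , v)) (allFin p)) (allFin p)

  sum-map-∑ᵖ : ∀ {a} {A : Set a} (F : A → Point p → ℕ) xs →
    sum (map (λ x → ∑ᵖ (F x)) xs) ≡ ∑ᵖ (λ P → sum (map (λ x → F x P) xs))
  sum-map-∑ᵖ F xs = trans (sum-map-comm _ xs (allFin p))
    (cong sum (map-cong (λ u → sum-map-comm _ xs (allFin p)) (allFin p)))

-- The pencil of lines through a point

Line : ℕ → Set
Line p = Direction p × Fin p

module _ (p : ℕ) .{{_ : NonZero p}} where

  _∈ᴸ_ : Point p → Line p → Set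
  P ∈ᴸ (d , k) = onLine p d k P ≡ true

  DistinctDirections : Line p → Line p → Set
  DistinctDirections = _≢_ on proj₁

  parameterThrough : Point p → Direction p → Fin p
  parameterThrough (u , v) nothing  = u
  parameterThrough (u , v) (just m) = (toℕ m * toℕ u + (p ∸ toℕ v)) mod p   -- p ∸ v stands for −v

  lineThrough : Point p → Direction p → Line p
  lineThrough P d = d , parameterThrough P d

  ∈-lineThrough : ∀ P d → P ∈ᴸ lineThrough P d
  ∈-lineThrough (u , v) nothing  = Equivalence.to T-≡ (≡⇒≡ᵇ (toℕ u) (toℕ u) refl)
  ∈-lineThrough (u , v) (just m) = Equivalence.to T-≡ (≡⇒≡ᵇ _ _ (begin
    (toℕ v + toℕ ((mu + (p ∸ toℕ v)) mod p)) % p ≡⟨ cong (λ k → (toℕ v + k) % p) (toℕ-fromℕ< (m%n<n _ p)) ⟩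
    (toℕ v + (mu + (p ∸ toℕ v)) % p) % p       ≡⟨ %-distribˡ-+ (toℕ v) _ p ⟩
    (toℕ v % p + (mu + (p ∸ toℕ v)) % p % p) % p ≡⟨ cong (λ k → (toℕ v % p + k) % p) (m%n%n≡m%n _ p) ⟩
    (toℕ v % p + (mu + (p ∸ toℕ v)) % p) % p   ≡⟨ %-distribˡ-+ (toℕ v) _ p ⟨
    (toℕ v + (mu + (p ∸ toℕ v))) % p           ≡⟨ cong (_% p) (x+[y+[p∸x]]≡y+p mu (<⇒≤ (toℕ<n v))) ⟩
    (mu + p) % p                               ≡⟨ [m+n]%n≡m%n mu p ⟩
    mu % p                                     ∎))
    where
    open ≡-Reasoning
    mu = toℕ m * toℕ u
    x+[y+[p∸x]]≡y+p : ∀ {x} y → x ≤ p → x + (y + (p ∸ x)) ≡ y + p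
    x+[y+[p∸x]]≡y+p {x} y x≤p = trans (x∙yz≈y∙xz x y (p ∸ x)) (cong (y +_) (m+[n∸m]≡n x≤p))

  lineCountᴸ : SubsetP p → Line p → ℕ
  lineCountᴸ U (d , k) = lineCount p U d k

  otherDirection : Direction p → Fin p → Direction p
  otherDirection nothing  i = just i
  otherDirection (just m) i with i Fin.≟ m
  ... | yes _ = nothing
  ... | no  _ = just i

  otherDirection-≢ : ∀ d i → otherDirection d i ≢ d
  otherDirection-≢ nothing  i ()
  otherDirection-≢ (just m) i with i Fin.≟ m
  ... | yes _   = λ ()
  ... | no  i≢m = i≢m ∘ just-injective

  otherDirection-injective : ∀ d {i j} → otherDirection d i ≡ otherDirection d j → i ≡ j
  otherDirection-injective nothing refl = refl
  otherDirection-injective (just m) {i} {j} eq with i Fin.≟ m | j Fin.≟ m | eq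
  ... | yes i≡m | yes j≡m | _    = trans i≡m (sym j≡m)
  ... | no  _   | no  _   | refl = refl

  otherLinesThrough : Point p → Direction p → List (Line p)
  otherLinesThrough P d = map (lineThrough P ∘ otherDirection d) (allFin p)

  length-otherLinesThrough : ∀ P d → length (otherLinesThrough P d) ≡ p
  length-otherLinesThrough P d = trans (length-map _ (allFin p)) (length-tabulate id)

  ∈-otherLinesThrough : ∀ P d → All (P ∈ᴸ_) (otherLinesThrough P d)
  ∈-otherLinesThrough P d = All.map⁺ (universal (∈-lineThrough P ∘ otherDirection d) (allFin p))

  otherLinesThrough-≢ : ∀ P d → All (λ ℓ → d ≢ proj₁ ℓ) (otherLinesThrough P d)
  otherLinesThrough-≢ P d = All.map⁺ (universal (λ i → ≢-sym (otherDirection-≢ d i)) (allFin p))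

  otherLinesThrough-distinct : ∀ P d → AllPairs DistinctDirections (otherLinesThrough P d)
  otherLinesThrough-distinct P d =
    AllPairs.map⁺ (AllPairs.map (λ i≢j → i≢j ∘ otherDirection-injective d) (allFin⁺ p))

  lineInU⊎avoids : ∀ (U : SubsetP p) d k → LineInU p U d k ⊎ ∃[ P ] onLine p d k P ≡ true × U P ≡ false
  lineInU⊎avoids U d k
    with any? (λ u → any? (λ v → (onLine p d k (u , v) Bool.≟ true) ×-dec (U (u , v) Bool.≟ false)))
  ... | yes (u , v , on , ∉U) = inj₂ ((u , v) , on , ∉U)
  ... | no ∄                  = inj₁ (λ (u , v) on → ¬-not (λ ∉U → ∄ (u , v , on , ∉U)))

  linesThrough-coverOnce : Prime p → ∀ {P x} → x ≢ P → ∀ {L} → All (P ∈ᴸ_) L → AllPairs DistinctDirections L →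
    sum (map (λ (d , k) → indicator (onLine p d k x)) L) ≤ 1
  linesThrough-coverOnce p-prime x≢P [] [] = z≤n
  linesThrough-coverOnce p-prime {P} {x} x≢P {(d , k) ∷ L} (P∈ℓ ∷ P∈L) (ℓ≢L ∷ L-distinct)
    with onLine p d k x in x∈ℓ
  ... | false = linesThrough-coverOnce p-prime x≢P P∈L L-distinct
  ... | true  = ≤-reflexive (cong suc (sum-map-indicator≡0 (zipWith x∉ (P∈L , ℓ≢L))))
    where
    x∉ : ∀ {ℓ′} → P ∈ᴸ ℓ′ × DistinctDirections (d , k) ℓ′ → onLine p (proj₁ ℓ′) (proj₂ ℓ′) x ≢ true
    x∉ (P∈ℓ′ , ℓ≢ℓ′) x∈ℓ′ = x≢P (distinctDirections-meetOnce p p-prime ℓ≢ℓ′ x∈ℓ P∈ℓ x∈ℓ′ P∈ℓ′)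

  lineCounts-through≤card : Prime p → ∀ (U : SubsetP p) {P} → U P ≡ false →
    ∀ {L} → All (P ∈ᴸ_) L → AllPairs DistinctDirections L → sum (map (lineCountᴸ U) L) ≤ card p U
  lineCounts-through≤card p-prime U {P} P∉U {L} P∈L L-distinct = begin
    sum (map (lineCountᴸ U) L)                                                     ≡⟨ sum-map-∑ᵖ p _ L ⟩
    ∑ᵖ p (λ x → sum (map (λ (d , k) → indicator (onLine p d k x ∧ U x)) L))    ≤⟨ ∑ᵖ-mono-≤ p covered ⟩
    card p U                                                                   ∎
    where
    open ≤-Reasoning
    covered : ∀ x → sum (map (λ (d , k) → indicator (onLine p d k x ∧ U x)) L) ≤ indicator (U x)
    covered x rewrite sum-map-indicator-∧ʳ (λ (d , k) → onLine p d k x) (U x) L with U x in x∈U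
    ... | true  = *-monoˡ-≤ 1 (linesThrough-coverOnce p-prime (λ x≡P → not-¬ x∈U (trans (cong U x≡P) P∉U)) P∈L L-distinct)
    ... | false = ≤-reflexive (*-zeroʳ (sum (map (λ (d , k) → indicator (onLine p d k x)) L)))

[1+n]*p∸r≡p∸r+p*n : ∀ n {p r} → r ≤ p → suc n * p ∸ r ≡ (p ∸ r) + p * n
[1+n]*p∸r≡p∸r+p*n n {p} {r} r≤p = trans (+-∸-comm (n * p) r≤p) (cong ((p ∸ r) +_) (*-comm n p))

notPoor⇒≥ : ∀ {p n r c} → r ≤ p → ¬ (p * c + p ≤ suc n * p ∸ r) → n ≤ c
notPoor⇒≥ {p} {n} {r} {c} r≤p notPoor with n ≤? c
... | yes n≤c = n≤c
... | no  n≰c = contradiction (begin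
  p * c + p        ≡⟨ +-comm (p * c) p ⟩
  p + p * c        ≡⟨ *-suc p c ⟨
  p * suc c        ≤⟨ *-monoʳ-≤ p (≰⇒> n≰c) ⟩
  p * n            ≤⟨ m≤n+m (p * n) (p ∸ r) ⟩
  (p ∸ r) + p * n  ≡⟨ [1+n]*p∸r≡p∸r+p*n n r≤p ⟨
  suc n * p ∸ r    ∎) notPoor
  where open ≤-Reasoning

remainder≤p∸r : ∀ {p n r c S} → r ≤ p → p * n ≤ S → c + S ≤ suc n * p ∸ r → c ≤ p ∸ r
remainder≤p∸r {p} {n} {r} {c} {S} r≤p pn≤S c+S≤ = +-cancelʳ-≤ (p * n) c (p ∸ r) (begin
  c + p * n        ≤⟨ +-monoʳ-≤ c pn≤S ⟩
  c + S            ≤⟨ c+S≤ ⟩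
  suc n * p ∸ r    ≡⟨ [1+n]*p∸r≡p∸r+p*n n r≤p ⟩
  (p ∸ r) + p * n  ∎)
  where open ≤-Reasoning

lemma5p1 : (p : ℕ) .{{_ : NonZero p}} → Prime p →
           (U : SubsetP p) (n r : ℕ) →
           1 ≤ n → n < p → r < p → p ∸ r ≤ n →
           card p U ≡ n * p ∸ r →
           (m₀ : Direction p) →
           ((d : Direction p) → d ≢ m₀ → ¬ Special p U d) →
           (k : Fin p) → LineInU p U m₀ k ⊎ lineCount p U m₀ k ≤ p ∸ r
lemma5p1 p p-prime U (suc n) r (s≤s z≤n) _ r<p _ #U≡ m₀ onlyM₀Special k with lineInU⊎avoids p U m₀ k
... | inj₁ ℓ⊆U             = inj₁ ℓ⊆U
... | inj₂ (P , P∈ℓ , P∉U) = inj₂ (remainder≤p∸r r≤p others≥ (≤-trans all≤card (≤-reflexive #U≡)))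
  where
  r≤p : r ≤ p
  r≤p = <⇒≤ r<p
  others : List (Line p)
  others = otherLinesThrough p P m₀
  all≤card : lineCount p U m₀ k + sum (map (lineCountᴸ p U) others) ≤ card p U
  all≤card = lineCounts-through≤card p p-prime U P∉U
    (P∈ℓ ∷ ∈-otherLinesThrough p P m₀) (otherLinesThrough-≢ p P m₀ ∷ otherLinesThrough-distinct p P m₀)
  notPoor : ∀ {ℓ} → m₀ ≢ proj₁ ℓ → n ≤ lineCountᴸ p U ℓ
  notPoor {d , k′} m₀≢d = notPoor⇒≥ r≤p (λ poor →
    onlyM₀Special d (≢-sym m₀≢d) (k′ , inj₂ (≤-trans poor (≤-reflexive (sym #U≡)))))
  others≥ : p * n ≤ sum (map (lineCountᴸ p U) others)
  others≥ = subst (λ l → l * n ≤ sum (map (lineCountᴸ p U) others)) (length-otherLinesThrough p P m₀)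
    (length*c≤sum-map (All.map notPoor (otherLinesThrough-≢ p P m₀)))
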